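{- (1) For every $k\geq 1$, every orderable $k$-hypergraph is separable. (2) For $k=1,2$, every separable $k$-hypergraph is orderable; for each $k\geq 3$ there exists a separable $k$-hypergraph that is not orderable.
   Context: A $k$-hypergraph on a finite set $V$ is a set $\mathcal{H}$ of $k$-element subsets of $V$. Let $n=|V|$. $\mathcal{H}$ is orderable if there is an ordering $v_1,\dots,v_n$ of $V$ such that each $v_i$ is either dominating, meaning $E\in\mathcal{H}$ for every $k$-set $E$ with $v_i\in E\subseteq\{v_1,\dots,v_i\}$, or isolating, meaning $E\notin\mathcal{H}$ for every $k$-set $E$ with $v_i\in E\subseteq\{v_1,\dots,v_i\}$. $\mathcal{H}$ is separable if there is a labeling $a:V\to\mathbb{Z}$ with $\mathcal{H}=\{E\subseteq V:|E|=k,\ \sum_{v\in E}a(v)\geq 0\}$. -}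

module Defs where

open import Data.Nat using (ℕ; zero; suc)
open import Data.Bool using (Bool; true; false; if_then_else_)
open import Data.Fin using (Fin; _≤_)
open import Data.Fin.Subset using (Subset; _∈_; _∉_; _⊆_; ∣_∣)
open import Data.Fin.Permutation using (Permutation′; _⟨$⟩ʳ_)
open import Data.Integer as ℤ using (ℤ; 0ℤ)
open import Data.Vec using (Vec; []; _∷_)
open import Data.Product using (Σ; ∃; _×_)
open import Data.Sum using (_⊎_)
open import Relation.Binary.PropositionalEquality using (_≡_)
open import Function.Bundles using (_⇔_)

record Hypergraph (k n : ℕ) : Set where
  field
    edge    : Subset n → Bool
    uniform : ∀ E → edge E ≡ true → ∣ E ∣ ≡ k
open Hypergraph public

_∈ᴴ_ : ∀ {k n} → Subset n → Hypergraph k n → Set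
E ∈ᴴ H = edge H E ≡ true

weight : ∀ {n} → (Fin n → ℤ) → Subset n → ℤ
weight {zero}  a []       = 0ℤ
weight {suc n} a (b ∷ E)  =
  (if b then a Fin.zero else 0ℤ) ℤ.+ weight (λ i → a (Fin.suc i)) E

Prefix : ∀ {n} → Permutation′ n → Fin n → Subset n → Set
Prefix σ i E = ∀ v → v ∈ E → Σ (Fin _) λ j → (j ≤ i) × (σ ⟨$⟩ʳ j ≡ v)

Dominating : ∀ {k n} → Hypergraph k n → Permutation′ n → Fin n → Set
Dominating {k} H σ i =
  ∀ E → ∣ E ∣ ≡ k → (σ ⟨$⟩ʳ i) ∈ E → Prefix σ i E → E ∈ᴴ H

Isolating : ∀ {k n} → Hypergraph k n → Permutation′ n → Fin n → Set
Isolating {k} H σ i =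
  ∀ E → ∣ E ∣ ≡ k → (σ ⟨$⟩ʳ i) ∈ E → Prefix σ i E → E ∈ᴴ H → Data.Empty.⊥
  where import Data.Empty

Orderable : ∀ {k n} → Hypergraph k n → Set
Orderable H = ∃ λ σ → ∀ i → Dominating H σ i ⊎ Isolating H σ i

Separable : ∀ {k n} → Hypergraph k n → Set
Separable {k} H =
  ∃ λ (a : Fin _ → ℤ) → ∀ E → ∣ E ∣ ≡ k → (E ∈ᴴ H ⇔ 0ℤ ℤ.≤ weight a E)

-- Orderable ⇒ separable: for a k-hypergraph give the vertex in position i the label ±k^(i + 1),
-- with + for dominating and − for isolating vertices. In a k-set the latest vertex outweighs the
-- k − 1 others together, so the weight has the sign of that vertex, and whether it dominates or
-- isolates is exactly what decides membership.
-- Separable ⇒ orderable for k ≤ 2: list the vertices by |a|, a negative label before its opposite.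
-- A vertex with a ≥ 0 then outweighs every single earlier vertex, and one with a < 0 is outweighed
-- by none, so it is dominating resp. isolating.
-- For k ≥ 3 take the labels (1, 1, −1, −1, 0, …, 0) on k + 1 vertices: the k-sets are the
-- complements ⊤ - w, of weight − label w, and the last vertex of any ordering lies both in such an
-- edge and in such a non-edge.
module Submission where

open import Defs
open import Data.Bool using (Bool; true; _∧_)
open import Data.Bool.Properties using (T-≡; T-∧)
open import Data.Empty using (⊥-elim)
open import Data.Fin as Fin using (Fin; zero; suc; toℕ)
import Data.Fin.Properties as Finₚ
open import Data.Fin.Permutation
  using (Permutation′; _⟨$⟩ʳ_; _⟨$⟩ˡ_; inverseʳ; lift₀; transpose; _∘ₚ_)
import Data.Fin.Permutation as Permutation
open import Data.Fin.Subset
  using (Subset; inside; outside; _∈_; _∉_; _─_; _-_; ⁅_⁆; ⊤; ∣_∣; Nonempty)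
open import Data.Fin.Subset.Properties
  using (p─⊥≡p; x∉⁅y⁆⇒x≢y; x∈p∧x≢y⇒x∈p-y; p─q⊆p; nonempty?; Empty-unique; ∣⊥∣≡0; ∈⊤; ∣⊤∣≡n)
open import Data.Vec using ([]; _∷_; here; there)
open import Data.Integer as ℤ using (ℤ; +_; -[1+_]; 0ℤ; _+_; _*_; -_)
import Data.Integer.Properties as ℤₚ
open import Algebra.Properties.AbelianGroup ℤₚ.+-0-abelianGroup using (inverseʳ-unique)
open import Algebra.Properties.CommutativeSemigroup ℤₚ.+-commutativeSemigroup using (x∙yz≈y∙xz)
open import Data.Integer.Tactic.RingSolver using (solve-∀)
open import Data.Nat as ℕ using (ℕ; zero; suc; _≤_; _<_; _^_; z≤n; s≤s)
import Data.Nat.Properties as ℕₚ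
open import Data.Product using (Σ; ∃; _×_; _,_; proj₁; proj₂)
open import Data.Sum using (_⊎_; inj₁; inj₂)
open import Function using (_∘_)
open import Function.Bundles using (_⇔_; mk⇔; Equivalence)
open import Relation.Nullary using (¬_; yes; no; contradiction)
open import Relation.Nullary.Decidable using (⌊_⌋; toWitness; fromWitness)
open import Relation.Binary.PropositionalEquality

private variable
  n : ℕ
  p q : Subset n
  x y : Fin n

x∈p─q⇒x∉q : x ∈ p ─ q → x ∉ q
x∈p─q⇒x∉q {p = inside ∷ _} {q = outside ∷ _} here        ()
x∈p─q⇒x∉q {p = _ ∷ _}      {q = _ ∷ _}       (there x∈) (there y∈) = x∈p─q⇒x∉q x∈ y∈

x∈p-y⇒x≢y : x ∈ p - y → x ≢ y
x∈p-y⇒x≢y x∈p-y = x∉⁅y⁆⇒x≢y (x∈p─q⇒x∉q x∈p-y)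

x∈p⇒∣p∣≡1+∣p-x∣ : x ∈ p → ∣ p ∣ ≡ suc ∣ p - x ∣
x∈p⇒∣p∣≡1+∣p-x∣ {p = _ ∷ p}       here      = cong (suc ∘ ∣_∣) (sym (p─⊥≡p p))
x∈p⇒∣p∣≡1+∣p-x∣ {p = inside ∷ p}  (there x∈p) = cong suc (x∈p⇒∣p∣≡1+∣p-x∣ x∈p)
x∈p⇒∣p∣≡1+∣p-x∣ {p = outside ∷ p} (there x∈p) = x∈p⇒∣p∣≡1+∣p-x∣ x∈p

∣p∣≡1+m⇒Nonempty : ∀ {m} → ∣ p ∣ ≡ suc m → Nonempty p
∣p∣≡1+m⇒Nonempty {n} {p} ∣p∣≡1+m with nonempty? p
... | yes ne = ne
... | no ¬ne with () ← trans (sym ∣p∣≡1+m) (trans (cong ∣_∣ (Empty-unique ¬ne)) (∣⊥∣≡0 n))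

weight-─ : ∀ (a : Fin n → ℤ) → x ∈ p → weight a p ≡ a x + weight a (p - x)
weight-─ {p = _ ∷ p} a here =
  cong (_+_ (a zero)) (sym (trans (ℤₚ.+-identityˡ _) (cong (weight (a ∘ suc)) (p─⊥≡p p))))
weight-─ {x = suc x} {p = inside ∷ p} a (there x∈p) = begin
  a zero + weight (a ∘ suc) p                    ≡⟨ cong (_+_ (a zero)) (weight-─ (a ∘ suc) x∈p) ⟩
  a zero + (a (suc x) + weight (a ∘ suc) (p - x)) ≡⟨ x∙yz≈y∙xz (a zero) (a (suc x)) _ ⟩
  a (suc x) + (a zero + weight (a ∘ suc) (p - x)) ∎
  where open ≡-Reasoning
weight-─ {x = suc x} {p = outside ∷ p} a (there x∈p) = begin
  0ℤ + weight (a ∘ suc) p                         ≡⟨ ℤₚ.+-identityˡ _ ⟩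
  weight (a ∘ suc) p                              ≡⟨ weight-─ (a ∘ suc) x∈p ⟩
  a (suc x) + weight (a ∘ suc) (p - x)             ≡⟨ cong (_+_ (a (suc x))) (ℤₚ.+-identityˡ _) ⟨
  a (suc x) + (0ℤ + weight (a ∘ suc) (p - x))      ∎
  where open ≡-Reasoning

weight-mono : ∀ {a b : Fin n → ℤ} p → (∀ {x} → x ∈ p → a x ℤ.≤ b x) → weight a p ℤ.≤ weight b p
weight-mono []            a≤b = ℤₚ.≤-refl
weight-mono (inside ∷ p)  a≤b = ℤₚ.+-mono-≤ (a≤b here) (weight-mono p (a≤b ∘ there))
weight-mono (outside ∷ p) a≤b = ℤₚ.+-monoʳ-≤ 0ℤ (weight-mono p (a≤b ∘ there))

weight-const : ∀ (c : ℤ) (p : Subset n) → weight (λ _ → c) p ≡ + ∣ p ∣ * c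
weight-const c []            = refl
weight-const c (inside ∷ p)  = trans (cong (_+_ c) (weight-const c p)) (sym (ℤₚ.suc-* (+ ∣ p ∣) c))
weight-const c (outside ∷ p) = trans (ℤₚ.+-identityˡ _) (weight-const c p)

weight-≥ : ∀ {a : Fin n → ℤ} {c} → x ∈ p → (∀ {y} → y ∈ p - x → c ℤ.≤ a y) →
           a x + + ∣ p - x ∣ * c ℤ.≤ weight a p
weight-≥ {x = x} {p} {a} {c} x∈p c≤a = begin
  a x + + ∣ p - x ∣ * c          ≡⟨ cong (_+_ (a x)) (weight-const c (p - x)) ⟨
  a x + weight (λ _ → c) (p - x) ≤⟨ ℤₚ.+-monoʳ-≤ (a x) (weight-mono (p - x) c≤a) ⟩
  a x + weight a (p - x)         ≡⟨ weight-─ a x∈p ⟨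
  weight a p                     ∎
  where open ℤₚ.≤-Reasoning

weight-≤ : ∀ {a : Fin n → ℤ} {c} → x ∈ p → (∀ {y} → y ∈ p - x → a y ℤ.≤ c) →
           weight a p ℤ.≤ a x + + ∣ p - x ∣ * c
weight-≤ {x = x} {p} {a} {c} x∈p a≤c = begin
  weight a p                     ≡⟨ weight-─ a x∈p ⟩
  a x + weight a (p - x)         ≤⟨ ℤₚ.+-monoʳ-≤ (a x) (weight-mono (p - x) a≤c) ⟩
  a x + weight (λ _ → c) (p - x) ≡⟨ cong (_+_ (a x)) (weight-const c (p - x)) ⟩
  a x + + ∣ p - x ∣ * c          ∎
  where open ℤₚ.≤-Reasoning

isThresholdEdge : ∀ k → (Fin n → ℤ) → Subset n → Bool
isThresholdEdge k a E = ⌊ ∣ E ∣ ℕ.≟ k ⌋ ∧ ⌊ 0ℤ ℤ.≤? weight a E ⌋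

isThresholdEdge⇔ : ∀ k (a : Fin n → ℤ) E →
                   isThresholdEdge k a E ≡ true ⇔ (∣ E ∣ ≡ k × 0ℤ ℤ.≤ weight a E)
isThresholdEdge⇔ k a E = mk⇔
  (λ e → let size , sign = Equivalence.to T-∧ (Equivalence.from T-≡ e)
         in toWitness {a? = size?} size , toWitness {a? = sign?} sign)
  (λ (∣E∣≡k , 0≤w) → Equivalence.to T-≡
    (Equivalence.from (T-∧ {⌊ size? ⌋}) (fromWitness ∣E∣≡k , fromWitness 0≤w)))
  where
  size? = ∣ E ∣ ℕ.≟ k
  sign? = 0ℤ ℤ.≤? weight a E

thresholdHypergraph : ∀ k → (Fin n → ℤ) → Hypergraph k n
thresholdHypergraph k a = record
  { edge    = isThresholdEdge k a
  ; uniform = λ E → proj₁ ∘ Equivalence.to (isThresholdEdge⇔ k a E)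
  }

thresholdHypergraph-separable : ∀ k (a : Fin n → ℤ) → Separable (thresholdHypergraph k a)
thresholdHypergraph-separable k a = a , λ E ∣E∣≡k → mk⇔
  (proj₂ ∘ Equivalence.to (isThresholdEdge⇔ k a E))
  (λ 0≤w → Equivalence.from (isThresholdEdge⇔ k a E) (∣E∣≡k , 0≤w))

maximal : ∀ (f : Fin n → ℕ) {p} → Nonempty p → ∃ λ x → x ∈ p × (∀ {y} → y ∈ p → f y ≤ f x)
maximal f {outside ∷ p} (suc x , there x∈p) with maximal (f ∘ suc) (x , x∈p)
... | m , m∈p , max = suc m , there m∈p , λ { (there y∈p) → max y∈p }
maximal f {inside ∷ p} _ with nonempty? p
... | no ¬ne = zero , here , λ { here → ℕₚ.≤-refl ; (there y∈p) → contradiction (_ , y∈p) ¬ne }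
... | yes ne with maximal (f ∘ suc) ne
...   | m , m∈p , max with ℕₚ.≤-total (f zero) (f (suc m))
...     | inj₁ f0≤fm = suc m , there m∈p , λ { here → f0≤fm ; (there y∈p) → max y∈p }
...     | inj₂ fm≤f0 = zero , here , λ { here → ℕₚ.≤-refl ; (there y∈p) → ℕₚ.≤-trans (max y∈p) fm≤f0 }

minimal : ∀ (f : Fin (suc n) → ℕ) → ∃ λ x → ∀ y → f x ≤ f y
minimal {zero} f = zero , λ { zero → ℕₚ.≤-refl }
minimal {suc n} f with minimal (f ∘ suc)
... | m , min with ℕₚ.≤-total (f zero) (f (suc m))
...   | inj₁ f0≤fm = zero , λ { zero → ℕₚ.≤-refl ; (suc y) → ℕₚ.≤-trans f0≤fm (min y) }
...   | inj₂ fm≤f0 = suc m , λ { zero → fm≤f0 ; (suc y) → min y }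

sortBy : ∀ (f : Fin n → ℕ) →
         ∃ λ (σ : Permutation′ n) → ∀ {i j} → i Fin.≤ j → f (σ ⟨$⟩ʳ i) ≤ f (σ ⟨$⟩ʳ j)
sortBy {zero} f = Permutation.id , λ { {()} }
sortBy {suc n} f with minimal f
... | m , min with sortBy (f ∘ (transpose zero m ⟨$⟩ʳ_) ∘ suc)
...   | σ , sorted = lift₀ σ ∘ₚ transpose zero m , λ
  { {zero}          _         → min _
  ; {suc i} {suc j} (s≤s i≤j) → sorted i≤j
  }

Prefix-fromℕ : ∀ (σ : Permutation′ (suc n)) E → Prefix σ (Fin.fromℕ n) E
Prefix-fromℕ σ E u _ = σ ⟨$⟩ˡ u , Finₚ.≤fromℕ _ , inverseʳ σ

signed : ∀ {a b} {A : Set a} {B : Set b} → A ⊎ B → ℕ → ℤ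
signed (inj₁ _) m = + m
signed (inj₂ _) m = - + m

signed-bounded : ∀ {a b} {A : Set a} {B : Set b} (s : A ⊎ B) {m M} → m ≤ M →
                 - + M ℤ.≤ signed s m × signed s m ℤ.≤ + M
signed-bounded (inj₁ _) m≤M = ℤₚ.neg-≤-pos , ℤ.+≤+ m≤M
signed-bounded (inj₂ _) m≤M = ℤₚ.neg-mono-≤ (ℤ.+≤+ m≤M) , ℤₚ.neg-≤-pos

pivot-outweighs : ∀ k B → + (suc k ℕ.* B) + + k * - + B ≡ + B
pivot-outweighs k B = trans (cong (λ b → b + + k * - + B) (ℤₚ.pos-* (suc k) B)) (ring (+ k) (+ B))
  where
  ring : ∀ i j → (+ 1 + i) * j + i * - j ≡ j
  ring = solve-∀

pivot-outweighs⁻ : ∀ k B → - + (suc k ℕ.* B) + + k * + B ≡ - + B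
pivot-outweighs⁻ k B = trans (cong (λ b → - b + + k * + B) (ℤₚ.pos-* (suc k) B)) (ring (+ k) (+ B))
  where
  ring : ∀ i j → - ((+ 1 + i) * j) + i * j ≡ - j
  ring = solve-∀

module OrderableSeparable {k n} (H : Hypergraph (suc k) n) (σ : Permutation′ n)
                          (kind : ∀ i → Dominating H σ i ⊎ Isolating H σ i) where

  position : Fin n → ℕ
  position v = toℕ (σ ⟨$⟩ˡ v)

  position-injective : ∀ {u v} → position u ≡ position v → u ≡ v
  position-injective {u} {v} eq = begin
    u                   ≡⟨ inverseʳ σ ⟨
    σ ⟨$⟩ʳ (σ ⟨$⟩ˡ u)   ≡⟨ cong (σ ⟨$⟩ʳ_) (Finₚ.toℕ-injective eq) ⟩
    σ ⟨$⟩ʳ (σ ⟨$⟩ˡ v)   ≡⟨ inverseʳ σ ⟩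
    v                   ∎
    where open ≡-Reasoning

  label : Fin n → ℤ
  label v = signed (kind (σ ⟨$⟩ˡ v)) (suc k ^ suc (position v))

  separates : ∀ E → ∣ E ∣ ≡ suc k → E ∈ᴴ H ⇔ 0ℤ ℤ.≤ weight label E
  separates E ∣E∣≡1+k with maximal position (∣p∣≡1+m⇒Nonempty ∣E∣≡1+k)
  ... | v , v∈E , v-last = by-kind (kind i) refl
    where
    i = σ ⟨$⟩ˡ v
    B = suc k ^ position v

    ∣E-v∣≡k : ∣ E - v ∣ ≡ k
    ∣E-v∣≡k = ℕₚ.suc-injective (trans (sym (x∈p⇒∣p∣≡1+∣p-x∣ v∈E)) ∣E∣≡1+k)

    bounded : ∀ {u} → u ∈ E - v → - + B ℤ.≤ label u × label u ℤ.≤ + B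
    bounded u∈E-v = signed-bounded (kind _) (ℕₚ.^-monoʳ-≤ (suc k) earlier)
      where
      earlier = ℕₚ.≤∧≢⇒< (v-last (p─q⊆p _ _ u∈E-v)) (x∈p-y⇒x≢y u∈E-v ∘ position-injective)

    prefix : Prefix σ i E
    prefix u u∈E = σ ⟨$⟩ˡ u , v-last u∈E , inverseʳ σ

    σi∈E : σ ⟨$⟩ʳ i ∈ E
    σi∈E = subst (_∈ E) (sym (inverseʳ σ)) v∈E

    by-kind : (d : Dominating H σ i ⊎ Isolating H σ i) → label v ≡ signed d (suc k ℕ.* B) →
              E ∈ᴴ H ⇔ 0ℤ ℤ.≤ weight label E
    by-kind (inj₁ dom) ℓv = mk⇔ (λ _ → 0≤w) (λ _ → dom E ∣E∣≡1+k σi∈E prefix)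
      where
      open ℤₚ.≤-Reasoning
      0≤w = begin
        0ℤ                                ≤⟨ ℤ.+≤+ z≤n ⟩
        + B                               ≡⟨ pivot-outweighs k B ⟨
        + (suc k ℕ.* B) + + k * - + B     ≡⟨ cong₂ (λ ℓ s → ℓ + + s * - + B) ℓv ∣E-v∣≡k ⟨
        label v + + ∣ E - v ∣ * - + B     ≤⟨ weight-≥ v∈E (proj₁ ∘ bounded) ⟩
        weight label E                    ∎
    by-kind (inj₂ iso) ℓv = mk⇔ (⊥-elim ∘ iso E ∣E∣≡1+k σi∈E prefix) (⊥-elim ∘ ℤₚ.<⇒≱ w<0)
      where
      open ℤₚ.≤-Reasoning
      w<0 = begin-strict
        weight label E                    ≤⟨ weight-≤ v∈E (proj₂ ∘ bounded) ⟩
        label v + + ∣ E - v ∣ * + B       ≡⟨ cong₂ (λ ℓ s → ℓ + + s * + B) ℓv ∣E-v∣≡k ⟩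
        - + (suc k ℕ.* B) + + k * + B     ≡⟨ pivot-outweighs⁻ k B ⟩
        - + B                             <⟨ ℤₚ.neg-mono-< (ℤ.+<+ (ℕₚ.m^n>0 (suc k) (position v))) ⟩
        0ℤ                                ∎

orderable⇒separable : ∀ {k n} (H : Hypergraph (suc k) n) → Orderable H → Separable H
orderable⇒separable H (σ , kind) = label , separates
  where open OrderableSeparable H σ kind

-- Sorting by rank lists 0, −1, 1, −2, 2, …: by absolute value, a negative label before its opposite.
rank : ℤ → ℕ
rank (+ m)    = suc (m ℕ.+ m)
rank -[1+ m ] = suc (suc (m ℕ.+ m))

m+m≤1+n+n⇒m≤n : ∀ m n → m ℕ.+ m ≤ suc (n ℕ.+ n) → m ≤ n
m+m≤1+n+n⇒m≤n m n m+m≤1+n+n = ℕₚ.≮⇒≥ λ n<m → ℕₚ.<⇒≱ (2+n+n≤m+m n<m) m+m≤1+n+n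
  where
  2+n+n≤m+m : n < m → suc (suc (n ℕ.+ n)) ≤ m ℕ.+ m
  2+n+n≤m+m n<m = subst (_≤ m ℕ.+ m) (cong suc (ℕₚ.+-suc n n)) (ℕₚ.+-mono-≤ n<m n<m)

rank≤rank⁺⇒ : ∀ y m → rank y ≤ rank (+ m) → - + m ℤ.≤ y
rank≤rank⁺⇒ (+ _)     _       _                 = ℤₚ.neg-≤-pos
rank≤rank⁺⇒ -[1+ m′ ] (suc m) (s≤s (s≤s m′≤m)) =
  ℤ.-≤- (m+m≤1+n+n⇒m≤n m′ m (ℕₚ.≤-trans m′≤m (ℕₚ.≤-reflexive (ℕₚ.+-suc m m))))

rank≤rank⁻⇒ : ∀ y m → rank y ≤ rank -[1+ m ] → y ℤ.≤ + m
rank≤rank⁻⇒ (+ m′)    m (s≤s m′≤m) = ℤ.+≤+ (m+m≤1+n+n⇒m≤n m′ m m′≤m)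
rank≤rank⁻⇒ -[1+ _ ]  _ _          = ℤ.-≤+

j≤1⇒0≤m+j*-m : ∀ {j} m → j ≤ 1 → 0ℤ ℤ.≤ + m + + j * - + m
j≤1⇒0≤m+j*-m m z≤n = subst (0ℤ ℤ.≤_) (sym (ring (+ m))) (ℤ.+≤+ z≤n)
  where
  ring : ∀ x → x + + 0 * - x ≡ x
  ring = solve-∀
j≤1⇒0≤m+j*-m m (s≤s z≤n) = ℤₚ.≤-reflexive (sym (ring (+ m)))
  where
  ring : ∀ x → x + + 1 * - x ≡ + 0
  ring = solve-∀

j≤1⇒-[1+m]+j*m<0 : ∀ {j} m → j ≤ 1 → -[1+ m ] + + j * + m ℤ.< 0ℤ
j≤1⇒-[1+m]+j*m<0 m z≤n = subst (ℤ._< 0ℤ) (sym (ring (+ m))) ℤ.-<+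
  where
  ring : ∀ x → - (+ 1 + x) + + 0 * x ≡ - (+ 1 + x)
  ring = solve-∀
j≤1⇒-[1+m]+j*m<0 m (s≤s z≤n) = subst (ℤ._< 0ℤ) (sym (ring (+ m))) ℤ.-<+
  where
  ring : ∀ x → - (+ 1 + x) + + 1 * x ≡ - + 1
  ring = solve-∀

module SeparableOrderable {k n} (H : Hypergraph k n) (k≤2 : k ≤ 2)
                          (a : Fin n → ℤ) (separates : ∀ E → ∣ E ∣ ≡ k → E ∈ᴴ H ⇔ 0ℤ ℤ.≤ weight a E) where

  σ : Permutation′ n
  σ = proj₁ (sortBy (rank ∘ a))

  precedes : ∀ {i E u} → Prefix σ i E → u ∈ E → rank (a u) ≤ rank (a (σ ⟨$⟩ʳ i))
  precedes {u = u} prefix u∈E with prefix u u∈E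
  ... | j , j≤i , refl = proj₂ (sortBy (rank ∘ a)) j≤i

  precedes⁺ : ∀ {i E u m} → a (σ ⟨$⟩ʳ i) ≡ + m → Prefix σ i E → u ∈ E → - + m ℤ.≤ a u
  precedes⁺ {u = u} {m} ℓv prefix u∈E =
    rank≤rank⁺⇒ (a u) m (subst (λ ℓ → rank (a u) ≤ rank ℓ) ℓv (precedes prefix u∈E))

  precedes⁻ : ∀ {i E u m} → a (σ ⟨$⟩ʳ i) ≡ -[1+ m ] → Prefix σ i E → u ∈ E → a u ℤ.≤ + m
  precedes⁻ {u = u} {m} ℓv prefix u∈E =
    rank≤rank⁻⇒ (a u) m (subst (λ ℓ → rank (a u) ≤ rank ℓ) ℓv (precedes prefix u∈E))

  ∣E-v∣≤1 : ∀ {E : Subset n} {v} → ∣ E ∣ ≡ k → v ∈ E → ∣ E - v ∣ ≤ 1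
  ∣E-v∣≤1 ∣E∣≡k v∈E = ℕ.s≤s⁻¹ (subst (_≤ 2) (trans (sym ∣E∣≡k) (x∈p⇒∣p∣≡1+∣p-x∣ v∈E)) k≤2)

  dominating : ∀ {i m} → a (σ ⟨$⟩ʳ i) ≡ + m → Dominating H σ i
  dominating {i} {m} ℓv E ∣E∣≡k v∈E prefix = Equivalence.from (separates E ∣E∣≡k) (begin
    0ℤ                                 ≤⟨ j≤1⇒0≤m+j*-m m (∣E-v∣≤1 ∣E∣≡k v∈E) ⟩
    + m + + ∣ E - v ∣ * - + m          ≡⟨ cong (λ ℓ → ℓ + + ∣ E - v ∣ * - + m) ℓv ⟨
    a v + + ∣ E - v ∣ * - + m          ≤⟨ weight-≥ v∈E (precedes⁺ ℓv prefix ∘ p─q⊆p E ⁅ v ⁆) ⟩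
    weight a E                         ∎)
    where
    open ℤₚ.≤-Reasoning
    v = σ ⟨$⟩ʳ i

  isolating : ∀ {i m} → a (σ ⟨$⟩ʳ i) ≡ -[1+ m ] → Isolating H σ i
  isolating {i} {m} ℓv E ∣E∣≡k v∈E prefix e = ℤₚ.<⇒≱ w<0 (Equivalence.to (separates E ∣E∣≡k) e)
    where
    open ℤₚ.≤-Reasoning
    v = σ ⟨$⟩ʳ i
    w<0 = begin-strict
      weight a E                       ≤⟨ weight-≤ v∈E (precedes⁻ ℓv prefix ∘ p─q⊆p E ⁅ v ⁆) ⟩
      a v + + ∣ E - v ∣ * + m          ≡⟨ cong (λ ℓ → ℓ + + ∣ E - v ∣ * + m) ℓv ⟩
      -[1+ m ] + + ∣ E - v ∣ * + m     <⟨ j≤1⇒-[1+m]+j*m<0 m (∣E-v∣≤1 ∣E∣≡k v∈E) ⟩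
      0ℤ                               ∎

  kind : ∀ i → Dominating H σ i ⊎ Isolating H σ i
  kind i with a (σ ⟨$⟩ʳ i) in ℓv
  ... | + _      = inj₁ (dominating ℓv)
  ... | -[1+ _ ] = inj₂ (isolating ℓv)

separable⇒orderable : ∀ {k n} (H : Hypergraph k n) → k ≤ 2 → Separable H → Orderable H
separable⇒orderable H k≤2 (a , separates) = σ , kind
  where open SeparableOrderable H k≤2 a separates

module Counterexample (m : ℕ) where

  k : ℕ
  k = 3 ℕ.+ m

  label : Fin (suc k) → ℤ
  label zero                         = + 1
  label (suc zero)                   = + 1
  label (suc (suc zero))             = -[1+ 0 ]
  label (suc (suc (suc zero)))       = -[1+ 0 ]
  label (suc (suc (suc (suc _))))    = 0ℤ

  H : Hypergraph k (suc k)
  H = thresholdHypergraph k label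

  weight-⊤ : weight label ⊤ ≡ 0ℤ
  weight-⊤ = cong (λ w → + 1 + (+ 1 + (-[1+ 0 ] + (-[1+ 0 ] + w))))
                  (trans (weight-const 0ℤ (⊤ {m})) (ℤₚ.*-zeroʳ (+ ∣ ⊤ {m} ∣)))

  ∣⊤-w∣≡k : ∀ (w : Fin (suc k)) → ∣ ⊤ - w ∣ ≡ k
  ∣⊤-w∣≡k w = ℕₚ.suc-injective (trans (sym (x∈p⇒∣p∣≡1+∣p-x∣ (∈⊤ {x = w}))) (∣⊤∣≡n (suc k)))

  ∈⊤-w : ∀ {v w : Fin (suc k)} → v ≢ w → v ∈ ⊤ - w
  ∈⊤-w = x∈p∧x≢y⇒x∈p-y ∈⊤

  edge⇔ : ∀ (w : Fin (suc k)) → (⊤ - w) ∈ᴴ H ⇔ 0ℤ ℤ.≤ - label w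
  edge⇔ w = subst (λ x → (⊤ - w) ∈ᴴ H ⇔ 0ℤ ℤ.≤ x) weight-⊤-w
                  (proj₂ (thresholdHypergraph-separable k label) (⊤ - w) (∣⊤-w∣≡k w))
    where
    weight-⊤-w : weight label (⊤ - w) ≡ - label w
    weight-⊤-w = inverseʳ-unique (label w) _ (trans (sym (weight-─ label (∈⊤ {x = w}))) weight-⊤)

  another⁺ : ∀ v → ∃ λ w → v ≢ w × label w ≡ + 1
  another⁺ zero    = suc zero , (λ ()) , refl
  another⁺ (suc _) = zero , (λ ()) , refl

  another⁻ : ∀ v → ∃ λ w → v ≢ w × label w ≡ -[1+ 0 ]
  another⁻ zero                   = suc (suc zero) , (λ ()) , refl
  another⁻ (suc zero)             = suc (suc zero) , (λ ()) , refl
  another⁻ (suc (suc zero))       = suc (suc (suc zero)) , (λ ()) , refl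
  another⁻ (suc (suc (suc _)))    = suc (suc zero) , (λ ()) , refl

  not-orderable : ¬ Orderable H
  not-orderable (σ , kind) with σ ⟨$⟩ʳ Fin.fromℕ k | kind (Fin.fromℕ k)
  ... | v | inj₁ dom with another⁺ v
  ...   | w , v≢w , ℓw = ℤₚ.<⇒≱ ℤ.-<+ (subst (λ ℓ → 0ℤ ℤ.≤ - ℓ) ℓw (Equivalence.to (edge⇔ w)
            (dom (⊤ - w) (∣⊤-w∣≡k w) (∈⊤-w v≢w) (Prefix-fromℕ σ (⊤ - w)))))
  not-orderable (σ , kind) | v | inj₂ iso with another⁻ v
  ...   | w , v≢w , ℓw = iso (⊤ - w) (∣⊤-w∣≡k w) (∈⊤-w v≢w) (Prefix-fromℕ σ (⊤ - w))
            (Equivalence.from (edge⇔ w) (subst (λ ℓ → 0ℤ ℤ.≤ - ℓ) (sym ℓw) (ℤ.+≤+ z≤n)))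

proposition3p1 :
    ((k : ℕ) → 1 ≤ k → (n : ℕ) → (H : Hypergraph k n) → Orderable H → Separable H)
    × ((n : ℕ) → (H : Hypergraph 1 n) → Separable H → Orderable H)
    × ((n : ℕ) → (H : Hypergraph 2 n) → Separable H → Orderable H)
    × ((k : ℕ) → 3 ≤ k → Σ ℕ λ n → Σ (Hypergraph k n) λ H → Separable H × ¬ Orderable H)
proposition3p1 =
    (λ { _ (s≤s z≤n) n H → orderable⇒separable H })
  , (λ n H → separable⇒orderable H (s≤s z≤n))
  , (λ n H → separable⇒orderable H ℕₚ.≤-refl)
  , λ { _ (s≤s (s≤s (s≤s {n = m} _))) → let open Counterexample m in
          suc k , H , thresholdHypergraph-separable k label , not-orderable }
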